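{- Let $\mathcal{S}\subseteq\mathbb{Z}[i]$, $Q,L\ge 1$ and $R>0$. Then $$ \max\limits_{\substack{q_2\in \mathcal{S}\\ Q/2<\mathcal{N}(q_2)\le Q\\ r_2 \bmod q_2,\ (r_2,q_2)=1}} \#\left\{q\in \mathcal{S} \ : \ \mathcal{N}(q)\le LQ, \ \begin{pmatrix}f\left((uk+vl)/\mathcal{N}(q_2)\right)\\ f\left((-vk+ul)/\mathcal{N}(q_2)\right)\end{pmatrix}\in D_R(\mathbf{0})\right\} \ll \left(1+R^2Q\right)L, $$ where in the maximum $q_2=u_2+v_2i$, $r_2=x_2+y_2i$ ($u_2,v_2,x_2,y_2\in\mathbb{Z}$), $k:=x_2u_2+y_2v_2$, $l:=x_2v_2-y_2u_2$, and in the set $q=u+vi$ with $u,v\in\mathbb{Z}$. The implied constant is absolute.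
   Context: $\mathcal{N}(x)=x\overline{x}$ is the norm on $\mathbb{Z}[i]$. The maximum runs over $q_2\in\mathcal{S}$ with $Q/2<\mathcal{N}(q_2)\le Q$ and over residue classes $r_2$ modulo $q_2$ in $\mathbb{Z}[i]$ coprime to $q_2$. For real $z$, $f(z):=\{z+1/2\}-1/2$, where $\{\cdot\}$ is the fractional part. $D_R(\mathbf{0})$ is the closed disk in $\mathbb{R}^2$ of radius $R$ centered at the origin.
   Formalization: The parameters Q, L and R take rational values. -}

module Defs where

open import Data.Nat as ℕ using (ℕ; zero; suc)
open import Data.Integer as ℤ using (ℤ; +_)
open import Data.Rational as ℚ using (ℚ; ½; floor; _/_)
open import Data.Product using (_×_; _,_; ∃; proj₁; proj₂)
open import Relation.Binary.PropositionalEquality using (_≡_)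

-- Gaussian integers ℤ[i], a + b i represented as the pair (a , b)
GI : Set
GI = ℤ × ℤ

re im : GI → ℤ
re = proj₁
im = proj₂

_*ᵍ_ : GI → GI → GI
(a , b) *ᵍ (c , d) = (a ℤ.* c ℤ.- b ℤ.* d , a ℤ.* d ℤ.+ b ℤ.* c)

1ᵍ : GI
1ᵍ = (+ 1 , + 0)

_∣ᵍ_ : GI → GI → Set
d ∣ᵍ x = ∃ λ t → t *ᵍ d ≡ x

-- (r , q) = 1 in ℤ[i]: every common divisor is a unit (divides 1)
CoprimeGI : GI → GI → Set
CoprimeGI r q = ∀ d → d ∣ᵍ r → d ∣ᵍ q → d ∣ᵍ 1ᵍ

𝒩 : GI → ℕ
𝒩 (a , b) = ℤ.∣ a ℤ.* a ℤ.+ b ℤ.* b ∣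

-- a / n as a rational (n ≠ 0 in all uses; value 0 for n = 0 is a dummy)
_÷_ : ℤ → ℕ → ℚ
a ÷ zero = ℚ.0ℚ
a ÷ suc n = a / suc n

-- f(z) = {z + 1/2} - 1/2 = z - ⌊z + 1/2⌋
f : ℚ → ℚ
f z = z ℚ.- (floor (z ℚ.+ ½) / 1)

ℕtoℚ : ℕ → ℚ
ℕtoℚ n = + n / 1

InDisk : ℚ → GI → GI → GI → Set
InDisk R (u₂ , v₂) (x₂ , y₂) (u , v) =
  let k = x₂ ℤ.* u₂ ℤ.+ y₂ ℤ.* v₂
      l = x₂ ℤ.* v₂ ℤ.- y₂ ℤ.* u₂
      N = 𝒩 (u₂ , v₂)
      a = f ((u ℤ.* k ℤ.+ v ℤ.* l) ÷ N)
      b = f ((ℤ.- v ℤ.* k ℤ.+ u ℤ.* l) ÷ N)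
  in a ℚ.* a ℚ.+ b ℚ.* b ℚ.≤ R ℚ.* R

{-# OPTIONS --safe #-}
module Submission where

-- The point in the disc condition is the centred residue of q r₂ / q₂ modulo ℤ[i]: the two
-- fractions are the real part and minus the imaginary part of q r₂ conj(q₂) / 𝒩(q₂).  Hence
-- for each counted q the Gaussian integer t = q r₂ - g q₂, with g the Gaussian integer
-- nearest to q r₂ / q₂, has norm at most R² 𝒩(q₂) ≤ R² Q, while the nearest-integer quotient
-- κ of q by q₂ has norm at most 2 𝒩(q) / 𝒩(q₂) + 1 ≤ 4L + 1.  The map q ↦ (t, κ) is
-- injective: equal t give q₂ ∣ (x - y) r₂, so q₂ ∣ x - y by Bézout in the Euclidean ring
-- ℤ[i], and two elements of one residue class with the same rounded quotient coincide.
-- Since a disc of radius √X contains at most 8X + 2 Gaussian integers, the number of q is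
-- at most (8 R² Q + 2)(8 (4L + 1) + 2) ≤ 336 (1 + R² Q) L.

open import Defs
open import Level using (0ℓ)
open import Algebra.Bundles using (CommutativeRing)
open import Algebra.Structures using (IsCommutativeRing)
open import Tactic.RingSolver using (solve-∀; solve)
open import Tactic.RingSolver.Core.AlmostCommutativeRing using (AlmostCommutativeRing; fromCommutativeRing)
open import Data.Empty using (⊥-elim)
open import Data.Nat as ℕ using (ℕ; zero; suc)
import Data.Nat.Properties as ℕ
open import Data.Nat.Induction using (<-wellFounded)
open import Data.Nat.Coprimality as Coprime using ()
open import Data.Integer as ℤ using (ℤ; +_; -[1+_]; 0ℤ; _+_; _*_; _-_; -_; ∣_∣; _⊖_; _/ℕ_; _%ℕ_)
import Data.Integer.Properties as ℤ
open import Data.Integer.DivMod using (a≡a%ℕn+[a/ℕn]*n; n%ℕd<d)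
open import Data.Integer.Tactic.RingSolver using () renaming (ring to ℤ-ring)
open import Data.Nat.Tactic.RingSolver using () renaming (ring to ℕ-ring)
open import Data.Rational as ℚ using (ℚ; mkℚ; _/_; 0ℚ; 1ℚ; ½; floor)
import Data.Rational.Properties as ℚ
import Data.Rational.Unnormalised as ℚᵘ
import Data.Rational.Unnormalised.Properties as ℚᵘ
open import Data.List using (List; []; _∷_; length; map; _++_; applyUpTo; cartesianProduct)
open import Data.List.Properties using (length-++; length-map; length-applyUpTo; length-removeAt′)
open import Data.List.Relation.Unary.Any using (here; there; _─_; index)
open import Data.List.Relation.Unary.All as All using (All)
open import Data.List.Relation.Unary.AllPairs using (_∷_)
open import Data.List.Relation.Unary.Unique.Propositional using (Unique)
import Data.List.Relation.Unary.Unique.Propositional.Properties as Unique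
open import Data.List.Membership.Propositional using (_∈_)
open import Data.List.Membership.Propositional.Properties
  using (∈-++⁺ˡ; ∈-++⁺ʳ; ∈-applyUpTo⁺; ∈-map⁻; ∈-cartesianProduct⁺)
open import Data.List.Relation.Binary.Subset.Propositional using (_⊆_)
open import Data.Product using (_×_; _,_; ∃; ∃₂; proj₁; proj₂)
open import Data.Sum using ([_,_]′)
open import Function using (id)
open import Induction.WellFounded using (Acc; acc)
open import Relation.Nullary using (yes; no)
open import Relation.Nullary.Decidable using (dec⇒maybe)
open import Relation.Unary using (Decidable)
open import Relation.Binary.Definitions using (DecidableEquality)
open import Data.Product.Properties using (≡-dec)
open import Relation.Binary.PropositionalEquality

-- Gaussian integers

infixl 6 _+ᵍ_ _-ᵍ_
infix  8 -ᵍ_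

0ᵍ : GI
0ᵍ = (0ℤ , 0ℤ)

[_]ᵍ : ℤ → GI
[ n ]ᵍ = (n , 0ℤ)

_+ᵍ_ : GI → GI → GI
(a , b) +ᵍ (c , d) = (a + c , b + d)

-ᵍ_ : GI → GI
-ᵍ (a , b) = (- a , - b)

_-ᵍ_ : GI → GI → GI
x -ᵍ y = x +ᵍ -ᵍ y

conj : GI → GI
conj (a , b) = (a , - b)

∥_∥ : GI → ℤ
∥ (a , b) ∥ = a * a + b * b

_≟ᵍ_ : DecidableEquality GI
_≟ᵍ_ = ≡-dec ℤ._≟_ ℤ._≟_

+ᵍ-*ᵍ-isCommutativeRing : IsCommutativeRing _≡_ _+ᵍ_ _*ᵍ_ -ᵍ_ 0ᵍ 1ᵍ
+ᵍ-*ᵍ-isCommutativeRing = record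
  { isRing = record
    { +-isAbelianGroup = record
      { isGroup = record
        { isMonoid = record
          { isSemigroup = record
            { isMagma = record { isEquivalence = isEquivalence ; ∙-cong = cong₂ _+ᵍ_ }
            ; assoc = λ { (a , b) (c , d) (e , f) → cong₂ _,_ (ℤ.+-assoc a c e) (ℤ.+-assoc b d f) }
            }
          ; identity = (λ { (a , b) → cong₂ _,_ (ℤ.+-identityˡ a) (ℤ.+-identityˡ b) })
                     , (λ { (a , b) → cong₂ _,_ (ℤ.+-identityʳ a) (ℤ.+-identityʳ b) })
          }
        ; inverse = (λ { (a , b) → cong₂ _,_ (ℤ.+-inverseˡ a) (ℤ.+-inverseˡ b) })
                  , (λ { (a , b) → cong₂ _,_ (ℤ.+-inverseʳ a) (ℤ.+-inverseʳ b) })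
        ; ⁻¹-cong = cong (-ᵍ_)
        }
      ; comm = λ { (a , b) (c , d) → cong₂ _,_ (ℤ.+-comm a c) (ℤ.+-comm b d) }
      }
    ; *-cong = cong₂ _*ᵍ_
    ; *-assoc = λ { (a , b) (c , d) (e , f) → cong₂ _,_ (assoc₁ a b c d e f) (assoc₂ a b c d e f) }
    ; *-identity = (λ { (a , b) → cong₂ _,_ (identityˡ₁ a b) (identityˡ₂ a b) })
                 , (λ { (a , b) → cong₂ _,_ (identityʳ₁ a b) (identityʳ₂ a b) })
    ; distrib = (λ { (a , b) (c , d) (e , f) → cong₂ _,_ (distribˡ₁ a b c d e f) (distribˡ₂ a b c d e f) })
              , (λ { (a , b) (c , d) (e , f) → cong₂ _,_ (distribʳ₁ a b c d e f) (distribʳ₂ a b c d e f) })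
    }
  ; *-comm = λ { (a , b) (c , d) → cong₂ _,_ (comm₁ a b c d) (comm₂ a b c d) }
  }
  where
  assoc₁ : ∀ a b c d e f → (a * c - b * d) * e - (a * d + b * c) * f ≡ a * (c * e - d * f) - b * (c * f + d * e)
  assoc₁ = solve-∀ ℤ-ring
  assoc₂ : ∀ a b c d e f → (a * c - b * d) * f + (a * d + b * c) * e ≡ a * (c * f + d * e) + b * (c * e - d * f)
  assoc₂ = solve-∀ ℤ-ring
  identityˡ₁ : ∀ a b → + 1 * a - 0ℤ * b ≡ a
  identityˡ₁ = solve-∀ ℤ-ring
  identityˡ₂ : ∀ a b → + 1 * b + 0ℤ * a ≡ b
  identityˡ₂ = solve-∀ ℤ-ring
  identityʳ₁ : ∀ a b → a * + 1 - b * 0ℤ ≡ a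
  identityʳ₁ = solve-∀ ℤ-ring
  identityʳ₂ : ∀ a b → a * 0ℤ + b * + 1 ≡ b
  identityʳ₂ = solve-∀ ℤ-ring
  distribˡ₁ : ∀ a b c d e f → a * (c + e) - b * (d + f) ≡ (a * c - b * d) + (a * e - b * f)
  distribˡ₁ = solve-∀ ℤ-ring
  distribˡ₂ : ∀ a b c d e f → a * (d + f) + b * (c + e) ≡ (a * d + b * c) + (a * f + b * e)
  distribˡ₂ = solve-∀ ℤ-ring
  distribʳ₁ : ∀ a b c d e f → (c + e) * a - (d + f) * b ≡ (c * a - d * b) + (e * a - f * b)
  distribʳ₁ = solve-∀ ℤ-ring
  distribʳ₂ : ∀ a b c d e f → (c + e) * b + (d + f) * a ≡ (c * b + d * a) + (e * b + f * a)
  distribʳ₂ = solve-∀ ℤ-ring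
  comm₁ : ∀ a b c d → a * c - b * d ≡ c * a - d * b
  comm₁ = solve-∀ ℤ-ring
  comm₂ : ∀ a b c d → a * d + b * c ≡ c * b + d * a
  comm₂ = solve-∀ ℤ-ring

+ᵍ-*ᵍ-commutativeRing : CommutativeRing 0ℓ 0ℓ
+ᵍ-*ᵍ-commutativeRing = record { isCommutativeRing = +ᵍ-*ᵍ-isCommutativeRing }

ℤ[i]-ring : AlmostCommutativeRing 0ℓ 0ℓ
ℤ[i]-ring = fromCommutativeRing +ᵍ-*ᵍ-commutativeRing (λ x → dec⇒maybe (0ᵍ ≟ᵍ x))

0≤i*i : ∀ i → 0ℤ ℤ.≤ i * i
0≤i*i (+ n)    = subst (0ℤ ℤ.≤_) (ℤ.pos-* n n) (ℤ.+≤+ ℕ.z≤n)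
0≤i*i -[1+ n ] = ℤ.+≤+ ℕ.z≤n

0≤∥∥ : ∀ x → 0ℤ ℤ.≤ ∥ x ∥
0≤∥∥ (a , b) = ℤ.+-mono-≤ (0≤i*i a) (0≤i*i b)

+𝒩≡∥∥ : ∀ x → + 𝒩 x ≡ ∥ x ∥
+𝒩≡∥∥ x = ℤ.0≤i⇒+∣i∣≡i (0≤∥∥ x)

∥∥-* : ∀ x y → ∥ x *ᵍ y ∥ ≡ ∥ x ∥ * ∥ y ∥
∥∥-* (a , b) (c , d) = lagrange a b c d
  where
  lagrange : ∀ a b c d → (a * c - b * d) * (a * c - b * d) + (a * d + b * c) * (a * d + b * c)
                       ≡ (a * a + b * b) * (c * c + d * d)
  lagrange = solve-∀ ℤ-ring

∥conj∥ : ∀ x → ∥ conj x ∥ ≡ ∥ x ∥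
∥conj∥ (a , b) = square-neg a b
  where
  square-neg : ∀ a b → a * a + - b * - b ≡ a * a + b * b
  square-neg = solve-∀ ℤ-ring

∥∥-[] : ∀ n → ∥ [ n ]ᵍ ∥ ≡ n * n
∥∥-[] n = ℤ.+-identityʳ (n * n)

*ᵍ-[] : ∀ x n → x *ᵍ [ n ]ᵍ ≡ (re x * n , im x * n)
*ᵍ-[] (a , b) n = cong₂ _,_ (real a b n) (imaginary a b n)
  where
  real : ∀ a b n → a * n - b * 0ℤ ≡ a * n
  real = solve-∀ ℤ-ring
  imaginary : ∀ a b n → a * 0ℤ + b * n ≡ b * n
  imaginary = solve-∀ ℤ-ring

*-conj : ∀ x → x *ᵍ conj x ≡ [ + 𝒩 x ]ᵍ
*-conj x@(a , b) = cong₂ _,_ (trans (real a b) (sym (+𝒩≡∥∥ x))) (imaginary a b)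
  where
  real : ∀ a b → a * a - b * - b ≡ a * a + b * b
  real = solve-∀ ℤ-ring
  imaginary : ∀ a b → a * - b + b * a ≡ 0ℤ
  imaginary = solve-∀ ℤ-ring

∥-∥≤2∥∥+2∥∥ : ∀ x y → ∥ x -ᵍ y ∥ ℤ.≤ + 2 * ∥ x ∥ + + 2 * ∥ y ∥
∥-∥≤2∥∥+2∥∥ x@(a , b) y@(c , d) = begin
  ∥ x -ᵍ y ∥                 ≤⟨ ℤ.i≤i+j _ _ {{ℤ.nonNegative (0≤∥∥ (x +ᵍ y))}} ⟩
  ∥ x -ᵍ y ∥ + ∥ x +ᵍ y ∥    ≡⟨ parallelogram a b c d ⟩
  + 2 * ∥ x ∥ + + 2 * ∥ y ∥  ∎
  where
  open ℤ.≤-Reasoning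
  parallelogram : ∀ a b c d → ((a - c) * (a - c) + (b - d) * (b - d)) + ((a + c) * (a + c) + (b + d) * (b + d))
                            ≡ + 2 * (a * a + b * b) + + 2 * (c * c + d * d)
  parallelogram = solve-∀ ℤ-ring

square≡0⇒≡0 : ∀ i → i * i ≡ 0ℤ → i ≡ 0ℤ
square≡0⇒≡0 i i*i≡0 = [ id , id ]′ (ℤ.i*j≡0⇒i≡0∨j≡0 i i*i≡0)

𝒩≡0⇒≡0ᵍ : ∀ x → 𝒩 x ≡ 0 → x ≡ 0ᵍ
𝒩≡0⇒≡0ᵍ (a , b) 𝒩≡0 = cong₂ _,_ (square≡0⇒≡0 a a*a≡0) (square≡0⇒≡0 b b*b≡0)
  where
  sum≡0 : a * a + b * b ≡ 0ℤ
  sum≡0 = ℤ.∣i∣≡0⇒i≡0 𝒩≡0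
  a*a≡0 : a * a ≡ 0ℤ
  a*a≡0 = ℤ.≤-antisym (subst (a * a ℤ.≤_) sum≡0 (ℤ.i≤i+j (a * a) (b * b) {{ℤ.nonNegative (0≤i*i b)}})) (0≤i*i a)
  b*b≡0 : b * b ≡ 0ℤ
  b*b≡0 = ℤ.≤-antisym (subst (b * b ℤ.≤_) sum≡0 (ℤ.i≤j+i (b * b) (a * a) {{ℤ.nonNegative (0≤i*i a)}})) (0≤i*i b)

-- Rounding to the nearest integer

small-multiple≡0 : ∀ {a b d} e → a ℕ.< d → b ℕ.< d → + a - + b ≡ e * + d → e ≡ 0ℤ
small-multiple≡0 {a} {b} {d} e a<d b<d a-b≡ed =
  ℤ.∣i∣≡0⇒i≡0 (ℕ.n<1⇒n≡0 (ℕ.*-cancelʳ-< d ∣ e ∣ 1 ∣e∣d<d))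
  where
  open ℕ.≤-Reasoning
  ∣e∣d<d : ∣ e ∣ ℕ.* d ℕ.< 1 ℕ.* d
  ∣e∣d<d = begin-strict
    ∣ e ∣ ℕ.* d   ≡⟨ ℤ.abs-* e (+ d) ⟨
    ∣ e * + d ∣   ≡⟨ cong ∣_∣ a-b≡ed ⟨
    ∣ + a - + b ∣ ≡⟨ cong ∣_∣ (ℤ.m-n≡m⊖n a b) ⟩
    ∣ a ⊖ b ∣     ≤⟨ ℤ.∣m⊝n∣≤m⊔n a b ⟩
    a ℕ.⊔ b       <⟨ ℕ.⊔-pres-<m a<d b<d ⟩
    d             ≡⟨ ℕ.*-identityˡ d ⟨
    1 ℕ.* d       ∎

+-*-transpose : ∀ a b c e d → a + c * d ≡ b + e * d → a - b ≡ (e - c) * d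
+-*-transpose a b c e d a+cd≡b+ed = begin
  a - b                                     ≡⟨ regroup a b c e d ⟩
  (e - c) * d + ((a + c * d) - (b + e * d)) ≡⟨ cong (λ z → (e - c) * d + (z - (b + e * d))) a+cd≡b+ed ⟩
  (e - c) * d + ((b + e * d) - (b + e * d)) ≡⟨ cong (λ z → (e - c) * d + z) (ℤ.+-inverseʳ (b + e * d)) ⟩
  (e - c) * d + 0ℤ                          ≡⟨ ℤ.+-identityʳ ((e - c) * d) ⟩
  (e - c) * d                               ∎
  where
  open ≡-Reasoning
  regroup : ∀ a b c e d → a - b ≡ (e - c) * d + ((a + c * d) - (b + e * d))
  regroup = solve-∀ ℤ-ring

/ℕ-unique : ∀ n d .{{_ : ℕ.NonZero d}} {q r} → r ℕ.< d → n ≡ + r + q * + d → n /ℕ d ≡ q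
/ℕ-unique n d {q} {r} r<d n≡r+qd = sym (ℤ.i-j≡0⇒i≡j q (n /ℕ d)
  (small-multiple≡0 (q - n /ℕ d) (n%ℕd<d n d) r<d
    (+-*-transpose (+ (n %ℕ d)) (+ r) (n /ℕ d) q (+ d) (trans (sym (a≡a%ℕn+[a/ℕn]*n n d)) n≡r+qd))))

round : ℤ → (M : ℕ) → .{{ℕ.NonZero M}} → ℤ
round P M = ((+ 2 * P + + M) /ℕ (2 ℕ.* M)) {{ℕ.m*n≢0 2 M}}

round-division : ∀ P M .{{_ : ℕ.NonZero M}} →
                 ∃ λ r → r ℕ.< 2 ℕ.* M × + 2 * P + + M ≡ + r + round P M * (+ 2 * + M)
round-division P M = n %ℕ 2M , n%ℕd<d n 2M ,
  trans (a≡a%ℕn+[a/ℕn]*n n 2M) (cong (λ d → + (n %ℕ 2M) + round P M * d) (ℤ.pos-* 2 M))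
  where
  n : ℤ
  n = + 2 * P + + M
  2M : ℕ
  2M = 2 ℕ.* M
  instance
    2M≢0 : ℕ.NonZero 2M
    2M≢0 = ℕ.m*n≢0 2 M

round-error : ∀ P M .{{_ : ℕ.NonZero M}} →
              + 4 * ((P - round P M * + M) * (P - round P M * + M)) ℤ.≤ + M * + M
round-error P M with r , r<2M , 2P+M≡r+ρ2M ← round-division P M = begin
  + 4 * (w * w)                                       ≡⟨ four-squares w ⟩
  (+ 2 * w) * (+ 2 * w)                               ≡⟨ cong (λ z → z * z) 2w≡r-M ⟩
  (+ r - + M) * (+ r - + M)                           ≤⟨ ℤ.i≤i+j _ _ {{ℤ.nonNegative 0≤r[2M-r]}} ⟩
  (+ r - + M) * (+ r - + M) + + r * (+ 2 * + M - + r) ≡⟨ complete-square (+ r) (+ M) ⟩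
  + M * + M                                           ∎
  where
  open ℤ.≤-Reasoning
  ρ w : ℤ
  ρ = round P M
  w = P - ρ * + M
  four-squares : ∀ w → + 4 * (w * w) ≡ (+ 2 * w) * (+ 2 * w)
  four-squares = solve-∀ ℤ-ring
  complete-square : ∀ r M → (r - M) * (r - M) + r * (+ 2 * M - r) ≡ M * M
  complete-square = solve-∀ ℤ-ring
  expand : ∀ P M ρ → + 2 * (P - ρ * M) ≡ (+ 2 * P + M - ρ * (+ 2 * M)) - M
  expand = solve-∀ ℤ-ring
  cancel : ∀ r M ρ → (r + ρ * (+ 2 * M) - ρ * (+ 2 * M)) - M ≡ r - M
  cancel = solve-∀ ℤ-ring
  2w≡r-M : + 2 * w ≡ + r - + M
  2w≡r-M = trans (expand P (+ M) ρ)
    (trans (cong (λ z → (z - ρ * (+ 2 * + M)) - + M) 2P+M≡r+ρ2M) (cancel (+ r) (+ M) ρ))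
  0≤r[2M-r] : 0ℤ ℤ.≤ + r * (+ 2 * + M - + r)
  0≤r[2M-r] = subst (ℤ._≤ + r * (+ 2 * + M - + r)) (ℤ.*-zeroʳ (+ r))
    (ℤ.*-monoˡ-≤-nonNeg (+ r) (ℤ.i≤j⇒0≤j-i (subst (+ r ℤ.≤_) (ℤ.pos-* 2 M) (ℤ.+≤+ (ℕ.<⇒≤ r<2M)))))

round-+-* : ∀ P e M .{{_ : ℕ.NonZero M}} → round (P + e * + M) M ≡ round P M + e
round-+-* P e M with r , r<2M , 2P+M≡r+ρ2M ← round-division P M =
  /ℕ-unique _ (2 ℕ.* M) {{ℕ.m*n≢0 2 M}} r<2M (begin
    + 2 * (P + e * + M) + + M                  ≡⟨ expand P e (+ M) ⟩
    (+ 2 * P + + M) + e * (+ 2 * + M)          ≡⟨ cong (λ z → z + e * (+ 2 * + M)) 2P+M≡r+ρ2M ⟩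
    (+ r + ρ * (+ 2 * + M)) + e * (+ 2 * + M)  ≡⟨ regroup (+ r) ρ e (+ M) ⟩
    + r + (ρ + e) * (+ 2 * + M)                ≡⟨ cong (λ d → + r + (ρ + e) * d) (ℤ.pos-* 2 M) ⟨
    + r + (ρ + e) * + (2 ℕ.* M)                ∎)
  where
  open ≡-Reasoning
  ρ : ℤ
  ρ = round P M
  expand : ∀ P e M → + 2 * (P + e * M) + M ≡ (+ 2 * P + M) + e * (+ 2 * M)
  expand = solve-∀ ℤ-ring
  regroup : ∀ r ρ e M → (r + ρ * (+ 2 * M)) + e * (+ 2 * M) ≡ r + (ρ + e) * (+ 2 * M)
  regroup = solve-∀ ℤ-ring

-- Division with remainder in ℤ[i]

roundᵍ : GI → (M : ℕ) → .{{ℕ.NonZero M}} → GI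
roundᵍ (a , b) M = (round a M , round b M)

roundᵍ-error : ∀ P M .{{_ : ℕ.NonZero M}} → + 2 * ∥ P -ᵍ roundᵍ P M *ᵍ [ + M ]ᵍ ∥ ℤ.≤ + M * + M
roundᵍ-error P@(a , b) M = ℤ.*-cancelˡ-≤-pos _ _ (+ 2) (begin
  + 2 * (+ 2 * ∥ P -ᵍ κ *ᵍ [ + M ]ᵍ ∥)     ≡⟨ cong (λ z → + 2 * (+ 2 * ∥ P -ᵍ z ∥)) (*ᵍ-[] κ (+ M)) ⟩
  + 2 * (+ 2 * (w₁ * w₁ + w₂ * w₂))       ≡⟨ four-times w₁ w₂ ⟩
  + 4 * (w₁ * w₁) + + 4 * (w₂ * w₂)        ≤⟨ ℤ.+-mono-≤ (round-error a M) (round-error b M) ⟩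
  + M * + M + + M * + M                    ≡⟨ double (+ M * + M) ⟩
  + 2 * (+ M * + M)                        ∎)
  where
  open ℤ.≤-Reasoning
  κ : GI
  κ = roundᵍ P M
  w₁ w₂ : ℤ
  w₁ = a - round a M * + M
  w₂ = b - round b M * + M
  four-times : ∀ x y → + 2 * (+ 2 * (x * x + y * y)) ≡ + 4 * (x * x) + + 4 * (y * y)
  four-times = solve-∀ ℤ-ring
  double : ∀ x → x + x ≡ + 2 * x
  double = solve-∀ ℤ-ring

roundᵍ-+-* : ∀ P e M .{{_ : ℕ.NonZero M}} → roundᵍ (P +ᵍ e *ᵍ [ + M ]ᵍ) M ≡ roundᵍ P M +ᵍ e
roundᵍ-+-* P@(a , b) e@(e₁ , e₂) M = begin
  roundᵍ (P +ᵍ e *ᵍ [ + M ]ᵍ) M                     ≡⟨ cong (λ z → roundᵍ (P +ᵍ z) M) (*ᵍ-[] e (+ M)) ⟩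
  (round (a + e₁ * + M) M , round (b + e₂ * + M) M) ≡⟨ cong₂ _,_ (round-+-* a e₁ M) (round-+-* b e₂ M) ⟩
  roundᵍ P M +ᵍ e                                   ∎
  where open ≡-Reasoning

infixl 25 _divᵍ_ _modᵍ_

_divᵍ_ : GI → (b : GI) → .{{ℕ.NonZero (𝒩 b)}} → GI
a divᵍ b = roundᵍ (a *ᵍ conj b) (𝒩 b)

_modᵍ_ : GI → (b : GI) → .{{ℕ.NonZero (𝒩 b)}} → GI
a modᵍ b = a -ᵍ a divᵍ b *ᵍ b

+-positive : ∀ M .{{_ : ℕ.NonZero M}} → ℤ.Positive (+ M)
+-positive (suc _) = _

module _ (a b : GI) .{{_ : ℕ.NonZero (𝒩 b)}} where

  private
    M : ℤ
    M = + 𝒩 b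
    κ : GI
    κ = a divᵍ b
    instance
      M-positive : ℤ.Positive M
      M-positive = +-positive (𝒩 b)

  modᵍ-*-conj : a modᵍ b *ᵍ conj b ≡ a *ᵍ conj b -ᵍ κ *ᵍ [ M ]ᵍ
  modᵍ-*-conj = begin
    (a -ᵍ κ *ᵍ b) *ᵍ conj b            ≡⟨ distrib a κ b (conj b) ⟩
    a *ᵍ conj b -ᵍ κ *ᵍ (b *ᵍ conj b)  ≡⟨ cong (λ z → a *ᵍ conj b -ᵍ κ *ᵍ z) (*-conj b) ⟩
    a *ᵍ conj b -ᵍ κ *ᵍ [ M ]ᵍ         ∎
    where
    open ≡-Reasoning
    distrib : ∀ a κ b c → (a -ᵍ κ *ᵍ b) *ᵍ c ≡ a *ᵍ c -ᵍ κ *ᵍ (b *ᵍ c)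
    distrib = solve-∀ ℤ[i]-ring

  ∥modᵍ∥ : + 2 * ∥ a modᵍ b ∥ ℤ.≤ M
  ∥modᵍ∥ = ℤ.*-cancelʳ-≤-pos _ _ M (begin
    + 2 * ∥ a modᵍ b ∥ * M                ≡⟨ ℤ.*-assoc (+ 2) ∥ a modᵍ b ∥ M ⟩
    + 2 * (∥ a modᵍ b ∥ * M)              ≡⟨ cong (λ z → + 2 * (∥ a modᵍ b ∥ * z)) (trans (+𝒩≡∥∥ b) (sym (∥conj∥ b))) ⟩
    + 2 * (∥ a modᵍ b ∥ * ∥ conj b ∥)     ≡⟨ cong (+ 2 *_) (∥∥-* (a modᵍ b) (conj b)) ⟨
    + 2 * ∥ a modᵍ b *ᵍ conj b ∥          ≡⟨ cong (λ z → + 2 * ∥ z ∥) modᵍ-*-conj ⟩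
    + 2 * ∥ a *ᵍ conj b -ᵍ κ *ᵍ [ M ]ᵍ ∥  ≤⟨ roundᵍ-error (a *ᵍ conj b) (𝒩 b) ⟩
    M * M                                 ∎)
    where open ℤ.≤-Reasoning

  𝒩-modᵍ< : 𝒩 (a modᵍ b) ℕ.< 𝒩 b
  𝒩-modᵍ< = ℕ.*-cancelˡ-< 2 (𝒩 (a modᵍ b)) (𝒩 b) (begin-strict
    2 ℕ.* 𝒩 (a modᵍ b)  ≤⟨ ℤ.drop‿+≤+ (subst (ℤ._≤ M) 2∥modᵍ∥≡ ∥modᵍ∥) ⟩
    𝒩 b                 <⟨ ℕ.m<m+n (𝒩 b) (ℕ.>-nonZero⁻¹ (𝒩 b)) ⟩
    𝒩 b ℕ.+ 𝒩 b         ≡⟨ cong (𝒩 b ℕ.+_) (ℕ.+-identityʳ (𝒩 b)) ⟨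
    2 ℕ.* 𝒩 b           ∎)
    where
    open ℕ.≤-Reasoning
    2∥modᵍ∥≡ : + 2 * ∥ a modᵍ b ∥ ≡ + (2 ℕ.* 𝒩 (a modᵍ b))
    2∥modᵍ∥≡ = sym (trans (ℤ.pos-* 2 (𝒩 (a modᵍ b))) (cong (+ 2 *_) (+𝒩≡∥∥ (a modᵍ b))))

  divᵍ-+-* : ∀ e → (a +ᵍ e *ᵍ b) divᵍ b ≡ κ +ᵍ e
  divᵍ-+-* e = begin
    roundᵍ ((a +ᵍ e *ᵍ b) *ᵍ conj b) (𝒩 b)     ≡⟨ cong (λ z → roundᵍ z (𝒩 b)) (distrib a e b (conj b)) ⟩
    roundᵍ (a *ᵍ conj b +ᵍ e *ᵍ (b *ᵍ conj b)) (𝒩 b) ≡⟨ cong (λ z → roundᵍ (a *ᵍ conj b +ᵍ e *ᵍ z) (𝒩 b)) (*-conj b) ⟩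
    roundᵍ (a *ᵍ conj b +ᵍ e *ᵍ [ M ]ᵍ) (𝒩 b)   ≡⟨ roundᵍ-+-* (a *ᵍ conj b) e (𝒩 b) ⟩
    κ +ᵍ e                                     ∎
    where
    open ≡-Reasoning
    distrib : ∀ a e b c → (a +ᵍ e *ᵍ b) *ᵍ c ≡ a *ᵍ c +ᵍ e *ᵍ (b *ᵍ c)
    distrib = solve-∀ ℤ[i]-ring

  ∥divᵍ∥ : ∥ κ ∥ * M ℤ.≤ + 2 * ∥ a ∥ + M
  ∥divᵍ∥ = ℤ.*-cancelʳ-≤-pos _ _ M (begin
    ∥ κ ∥ * M * M                 ≡⟨ ℤ.*-assoc ∥ κ ∥ M M ⟩
    ∥ κ ∥ * (M * M)               ≡⟨ cong (∥ κ ∥ *_) (∥∥-[] M) ⟨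
    ∥ κ ∥ * ∥ [ M ]ᵍ ∥            ≡⟨ ∥∥-* κ [ M ]ᵍ ⟨
    ∥ κ *ᵍ [ M ]ᵍ ∥               ≡⟨ cong ∥_∥ (sub-sub P (κ *ᵍ [ M ]ᵍ)) ⟩
    ∥ P -ᵍ w ∥                    ≤⟨ ∥-∥≤2∥∥+2∥∥ P w ⟩
    + 2 * ∥ P ∥ + + 2 * ∥ w ∥     ≤⟨ ℤ.+-monoʳ-≤ (+ 2 * ∥ P ∥) (roundᵍ-error P (𝒩 b)) ⟩
    + 2 * ∥ P ∥ + M * M           ≡⟨ cong (λ z → + 2 * z + M * M) ∥P∥≡∥a∥M ⟩
    + 2 * (∥ a ∥ * M) + M * M     ≡⟨ factor ∥ a ∥ M ⟩
    (+ 2 * ∥ a ∥ + M) * M         ∎)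
    where
    open ℤ.≤-Reasoning
    P w : GI
    P = a *ᵍ conj b
    w = P -ᵍ κ *ᵍ [ M ]ᵍ
    sub-sub : ∀ P x → x ≡ P -ᵍ (P -ᵍ x)
    sub-sub = solve-∀ ℤ[i]-ring
    ∥P∥≡∥a∥M : ∥ P ∥ ≡ ∥ a ∥ * M
    ∥P∥≡∥a∥M = trans (∥∥-* a (conj b)) (cong (∥ a ∥ *_) (trans (∥conj∥ b) (sym (+𝒩≡∥∥ b))))
    factor : ∀ x M → + 2 * (x * M) + M * M ≡ (+ 2 * x + M) * M
    factor = solve-∀ ℤ-ring

≡-mod-divᵍ : ∀ x y b .{{_ : ℕ.NonZero (𝒩 b)}} → b ∣ᵍ (x -ᵍ y) → x divᵍ b ≡ y divᵍ b → x ≡ y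
≡-mod-divᵍ x y b (e , eb≡x-y) x/b≡y/b = begin
  x                 ≡⟨ x≡y+eb ⟩
  y +ᵍ e *ᵍ b       ≡⟨ cong (λ e → y +ᵍ e *ᵍ b) e≡0 ⟩
  y +ᵍ 0ᵍ *ᵍ b      ≡⟨ solve (y ∷ b ∷ []) ℤ[i]-ring ⟩
  y                 ∎
  where
  open ≡-Reasoning
  x≡y+eb : x ≡ y +ᵍ e *ᵍ b
  x≡y+eb = begin
    x               ≡⟨ solve (x ∷ y ∷ []) ℤ[i]-ring ⟩
    y +ᵍ (x -ᵍ y)   ≡⟨ cong (y +ᵍ_) eb≡x-y ⟨
    y +ᵍ e *ᵍ b     ∎
  e≡0 : e ≡ 0ᵍ
  e≡0 = begin
    e                                ≡⟨ add-sub (y divᵍ b) e ⟩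
    (y divᵍ b +ᵍ e) -ᵍ y divᵍ b      ≡⟨ cong (_-ᵍ y divᵍ b) (divᵍ-+-* y b e) ⟨
    (y +ᵍ e *ᵍ b) divᵍ b -ᵍ y divᵍ b ≡⟨ cong (λ z → z divᵍ b -ᵍ y divᵍ b) x≡y+eb ⟨
    x divᵍ b -ᵍ y divᵍ b             ≡⟨ cong (_-ᵍ y divᵍ b) x/b≡y/b ⟩
    y divᵍ b -ᵍ y divᵍ b             ≡⟨ sub-self (y divᵍ b) ⟩
    0ᵍ                               ∎
    where
    add-sub : ∀ κ e → e ≡ (κ +ᵍ e) -ᵍ κ
    add-sub = solve-∀ ℤ[i]-ring
    sub-self : ∀ κ → κ -ᵍ κ ≡ 0ᵍ
    sub-self = solve-∀ ℤ[i]-ring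

-- Bézout's identity and cancellation of coprime factors

record Bezout (a b : GI) : Set where
  constructor bezout
  field
    gcd x y : GI
    gcd∣a : gcd ∣ᵍ a
    gcd∣b : gcd ∣ᵍ b
    identity : x *ᵍ a +ᵍ y *ᵍ b ≡ gcd

bezout-0ᵍ : ∀ a → Bezout a 0ᵍ
bezout-0ᵍ a = bezout a 1ᵍ 0ᵍ (1ᵍ , solve (a ∷ []) ℤ[i]-ring) (0ᵍ , refl) (solve (a ∷ []) ℤ[i]-ring)

bezout-modᵍ : ∀ a b .{{_ : ℕ.NonZero (𝒩 b)}} → Bezout b (a modᵍ b) → Bezout a b
bezout-modᵍ a b (bezout d x y (t₁ , t₁d≡b) (t₂ , t₂d≡a%b) xb+y[a%b]≡d) =
  bezout d y (x -ᵍ y *ᵍ κ) (κ *ᵍ t₁ +ᵍ t₂ , d∣a) (t₁ , t₁d≡b) ya+[x-yκ]b≡d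
  where
  open ≡-Reasoning
  κ : GI
  κ = a divᵍ b
  d∣a : (κ *ᵍ t₁ +ᵍ t₂) *ᵍ d ≡ a
  d∣a = begin
    (κ *ᵍ t₁ +ᵍ t₂) *ᵍ d          ≡⟨ distrib κ t₁ t₂ d ⟩
    κ *ᵍ (t₁ *ᵍ d) +ᵍ t₂ *ᵍ d     ≡⟨ cong₂ (λ u v → κ *ᵍ u +ᵍ v) t₁d≡b t₂d≡a%b ⟩
    κ *ᵍ b +ᵍ (a -ᵍ κ *ᵍ b)       ≡⟨ cancel κ b a ⟩
    a                             ∎
    where
    distrib : ∀ κ t₁ t₂ d → (κ *ᵍ t₁ +ᵍ t₂) *ᵍ d ≡ κ *ᵍ (t₁ *ᵍ d) +ᵍ t₂ *ᵍ d
    distrib = solve-∀ ℤ[i]-ring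
    cancel : ∀ κ b a → κ *ᵍ b +ᵍ (a -ᵍ κ *ᵍ b) ≡ a
    cancel = solve-∀ ℤ[i]-ring
  ya+[x-yκ]b≡d : y *ᵍ a +ᵍ (x -ᵍ y *ᵍ κ) *ᵍ b ≡ d
  ya+[x-yκ]b≡d = trans (regroup y a x κ b) xb+y[a%b]≡d
    where
    regroup : ∀ y a x κ b → y *ᵍ a +ᵍ (x -ᵍ y *ᵍ κ) *ᵍ b ≡ x *ᵍ b +ᵍ y *ᵍ (a -ᵍ κ *ᵍ b)
    regroup = solve-∀ ℤ[i]-ring

bezoutᵍ : ∀ a b → Bezout a b
bezoutᵍ a b = go a b (<-wellFounded (𝒩 b))
  where
  go : ∀ a b → Acc ℕ._<_ (𝒩 b) → Bezout a b
  go a b (acc smaller) with 𝒩 b ℕ.≟ 0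
  ... | yes 𝒩b≡0 = subst (Bezout a) (sym (𝒩≡0⇒≡0ᵍ b 𝒩b≡0)) (bezout-0ᵍ a)
  ... | no 𝒩b≢0 = bezout-modᵍ a b (go b (a modᵍ b) (smaller (𝒩-modᵍ< a b)))
    where
    instance
      b≢0 : ℕ.NonZero (𝒩 b)
      b≢0 = ℕ.≢-nonZero 𝒩b≢0

coprime⇒bezout-1 : ∀ {r q} → CoprimeGI r q → ∃₂ λ x y → x *ᵍ r +ᵍ y *ᵍ q ≡ 1ᵍ
coprime⇒bezout-1 {r} {q} coprime = e *ᵍ x , e *ᵍ y , (begin
  (e *ᵍ x) *ᵍ r +ᵍ (e *ᵍ y) *ᵍ q  ≡⟨ factor e x r y q ⟩
  e *ᵍ (x *ᵍ r +ᵍ y *ᵍ q)         ≡⟨ cong (e *ᵍ_) identity ⟩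
  e *ᵍ gcd                        ≡⟨ proj₂ gcd∣1 ⟩
  1ᵍ                              ∎)
  where
  open ≡-Reasoning
  open Bezout (bezoutᵍ r q)
  gcd∣1 : gcd ∣ᵍ 1ᵍ
  gcd∣1 = coprime gcd gcd∣a gcd∣b
  e : GI
  e = proj₁ gcd∣1
  factor : ∀ e x r y q → (e *ᵍ x) *ᵍ r +ᵍ (e *ᵍ y) *ᵍ q ≡ e *ᵍ (x *ᵍ r +ᵍ y *ᵍ q)
  factor = solve-∀ ℤ[i]-ring

coprime-∣-cancel : ∀ {r q} s → CoprimeGI r q → q ∣ᵍ (s *ᵍ r) → q ∣ᵍ s
coprime-∣-cancel {r} {q} s coprime (h , hq≡sr) = x *ᵍ h +ᵍ s *ᵍ y , (begin
  (x *ᵍ h +ᵍ s *ᵍ y) *ᵍ q         ≡⟨ expand x h s y q ⟩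
  x *ᵍ (h *ᵍ q) +ᵍ s *ᵍ (y *ᵍ q)  ≡⟨ cong (λ z → x *ᵍ z +ᵍ s *ᵍ (y *ᵍ q)) hq≡sr ⟩
  x *ᵍ (s *ᵍ r) +ᵍ s *ᵍ (y *ᵍ q)  ≡⟨ factor x s r y q ⟩
  s *ᵍ (x *ᵍ r +ᵍ y *ᵍ q)         ≡⟨ cong (s *ᵍ_) xr+yq≡1 ⟩
  s *ᵍ 1ᵍ                         ≡⟨ CommutativeRing.*-identityʳ +ᵍ-*ᵍ-commutativeRing s ⟩
  s                               ∎)
  where
  open ≡-Reasoning
  x y : GI
  x = proj₁ (coprime⇒bezout-1 coprime)
  y = proj₁ (proj₂ (coprime⇒bezout-1 coprime))
  xr+yq≡1 : x *ᵍ r +ᵍ y *ᵍ q ≡ 1ᵍ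
  xr+yq≡1 = proj₂ (proj₂ (coprime⇒bezout-1 coprime))
  expand : ∀ x h s y q → (x *ᵍ h +ᵍ s *ᵍ y) *ᵍ q ≡ x *ᵍ (h *ᵍ q) +ᵍ s *ᵍ (y *ᵍ q)
  expand = solve-∀ ℤ[i]-ring
  factor : ∀ x s r y q → x *ᵍ (s *ᵍ r) +ᵍ s *ᵍ (y *ᵍ q) ≡ s *ᵍ (x *ᵍ r +ᵍ y *ᵍ q)
  factor = solve-∀ ℤ[i]-ring

-- Integers and natural numbers inside ℚ

ℚ-ring : AlmostCommutativeRing 0ℓ 0ℓ
ℚ-ring = fromCommutativeRing ℚ.+-*-commutativeRing (λ x → dec⇒maybe (0ℚ ℚ.≟ x))

ℤtoℚ : ℤ → ℚ
ℤtoℚ i = i / 1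

ℤtoℚ≡mkℚ : ∀ i → ℤtoℚ i ≡ mkℚ i 0 (Coprime.sym (Coprime.1-coprimeTo ∣ i ∣))
ℤtoℚ≡mkℚ (+ n)    = ℚ.normalize-coprime (Coprime.sym (Coprime.1-coprimeTo n))
ℤtoℚ≡mkℚ -[1+ n ] = cong ℚ.-_ (ℚ.normalize-coprime (Coprime.sym (Coprime.1-coprimeTo (suc n))))

-- With denominators 1 the ℚ operations compute to the ℤ ones up to factors * + 1.
ℤtoℚ-+ : ∀ i j → ℤtoℚ (i + j) ≡ ℤtoℚ i ℚ.+ ℤtoℚ j
ℤtoℚ-+ i j = trans (cong ℤtoℚ (cong₂ _+_ (sym (ℤ.*-identityʳ i)) (sym (ℤ.*-identityʳ j))))
                   (sym (cong₂ ℚ._+_ (ℤtoℚ≡mkℚ i) (ℤtoℚ≡mkℚ j)))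

ℤtoℚ-* : ∀ i j → ℤtoℚ (i * j) ≡ ℤtoℚ i ℚ.* ℤtoℚ j
ℤtoℚ-* i j = sym (cong₂ ℚ._*_ (ℤtoℚ≡mkℚ i) (ℤtoℚ≡mkℚ j))

ℤtoℚ-neg : ∀ i → ℤtoℚ (- i) ≡ ℚ.- ℤtoℚ i
ℤtoℚ-neg i = trans (ℤtoℚ≡mkℚ (- i)) (sym (trans (cong ℚ.-_ (ℤtoℚ≡mkℚ i)) (neg-mkℚ i)))
  where
  neg-mkℚ : ∀ i → ℚ.- mkℚ i 0 (Coprime.sym (Coprime.1-coprimeTo ∣ i ∣))
                ≡ mkℚ (- i) 0 (Coprime.sym (Coprime.1-coprimeTo ∣ - i ∣))
  neg-mkℚ (+ zero)  = refl
  neg-mkℚ (+ suc n) = refl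
  neg-mkℚ -[1+ n ]  = refl

ℤtoℚ-- : ∀ i j → ℤtoℚ (i - j) ≡ ℤtoℚ i ℚ.- ℤtoℚ j
ℤtoℚ-- i j = trans (ℤtoℚ-+ i (- j)) (cong (ℤtoℚ i ℚ.+_) (ℤtoℚ-neg j))

ℤtoℚ-mono-≤ : ∀ {i j} → i ℤ.≤ j → ℤtoℚ i ℚ.≤ ℤtoℚ j
ℤtoℚ-mono-≤ {i} {j} i≤j = subst₂ ℚ._≤_ (sym (ℤtoℚ≡mkℚ i)) (sym (ℤtoℚ≡mkℚ j))
  (ℚ.*≤* (subst₂ ℤ._≤_ (sym (ℤ.*-identityʳ i)) (sym (ℤ.*-identityʳ j)) i≤j))

ℤtoℚ-cancel-≤ : ∀ {i j} → ℤtoℚ i ℚ.≤ ℤtoℚ j → i ℤ.≤ j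
ℤtoℚ-cancel-≤ {i} {j} i≤j with subst₂ ℚ._≤_ (ℤtoℚ≡mkℚ i) (ℤtoℚ≡mkℚ j) i≤j
... | ℚ.*≤* i*1≤j*1 = subst₂ ℤ._≤_ (ℤ.*-identityʳ i) (ℤ.*-identityʳ j) i*1≤j*1

ℕtoℚ-mono-≤ : ∀ {m n} → m ℕ.≤ n → ℕtoℚ m ℚ.≤ ℕtoℚ n
ℕtoℚ-mono-≤ m≤n = ℤtoℚ-mono-≤ (ℤ.+≤+ m≤n)

0≤ℕtoℚ : ∀ n → 0ℚ ℚ.≤ ℕtoℚ n
0≤ℕtoℚ n = ℕtoℚ-mono-≤ (ℕ.z≤n {n})

ℕtoℚ-+ : ∀ m n → ℕtoℚ (m ℕ.+ n) ≡ ℕtoℚ m ℚ.+ ℕtoℚ n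
ℕtoℚ-+ m n = trans (cong ℤtoℚ (ℤ.pos-+ m n)) (ℤtoℚ-+ (+ m) (+ n))

ℕtoℚ-* : ∀ m n → ℕtoℚ (m ℕ.* n) ≡ ℕtoℚ m ℚ.* ℕtoℚ n
ℕtoℚ-* m n = trans (cong ℤtoℚ (ℤ.pos-* m n)) (ℤtoℚ-* (+ m) (+ n))

ℕtoℚ-positive : ∀ n .{{_ : ℕ.NonZero n}} → ℚ.Positive (ℕtoℚ n)
ℕtoℚ-positive (suc n) = subst ℚ.Positive (sym (ℤtoℚ≡mkℚ (+ suc n))) _

/-*-cancel : ∀ i n .{{_ : ℕ.NonZero n}} → (i / n) ℚ.* ℕtoℚ n ≡ ℤtoℚ i
/-*-cancel i n@(suc n-1) = ℚ.toℚᵘ-injective (begin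
  ℚ.toℚᵘ ((i / n) ℚ.* ℕtoℚ n)                  ≈⟨ ℚ.toℚᵘ-homo-* (i / n) (ℕtoℚ n) ⟩
  ℚ.toℚᵘ (i / n) ℚᵘ.* ℚ.toℚᵘ (ℕtoℚ n)
    ≈⟨ ℚᵘ.*-cong (ℚ.toℚᵘ-fromℚᵘ (ℚᵘ.mkℚᵘ i n-1)) (ℚ.toℚᵘ-fromℚᵘ (ℚᵘ.mkℚᵘ (+ n) 0)) ⟩
  ℚᵘ.mkℚᵘ i n-1 ℚᵘ.* ℚᵘ.mkℚᵘ (+ n) 0           ≈⟨ ℚᵘ.*≡* cross-multiply ⟩
  ℚᵘ.mkℚᵘ i 0                                   ≈⟨ ℚ.toℚᵘ-fromℚᵘ (ℚᵘ.mkℚᵘ i 0) ⟨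
  ℚ.toℚᵘ (ℤtoℚ i)                               ∎)
  where
  open ℚᵘ.≃-Reasoning
  cross-multiply : (i * + n) * + 1 ≡ i * + suc (n-1 ℕ.* 1)
  cross-multiply = trans (ℤ.*-identityʳ (i * + n)) (cong (λ m → i * + suc m) (sym (ℕ.*-identityʳ n-1)))

*-mono-≤-nonNeg : ∀ {p q r s} → 0ℚ ℚ.≤ p → 0ℚ ℚ.≤ s → p ℚ.≤ q → r ℚ.≤ s → p ℚ.* r ℚ.≤ q ℚ.* s
*-mono-≤-nonNeg {p} {q} {r} {s} 0≤p 0≤s p≤q r≤s = ℚ.≤-trans
  (ℚ.*-monoˡ-≤-nonNeg p {{ℚ.nonNegative 0≤p}} r≤s) (ℚ.*-monoʳ-≤-nonNeg s {{ℚ.nonNegative 0≤s}} p≤q)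

*-nonNeg : ∀ {p q} → 0ℚ ℚ.≤ p → 0ℚ ℚ.≤ q → 0ℚ ℚ.≤ p ℚ.* q
*-nonNeg {p} {q} 0≤p 0≤q =
  ℚ.nonNegative⁻¹ _ {{ℚ.nonNeg*nonNeg⇒nonNeg p {{ℚ.nonNegative 0≤p}} q {{ℚ.nonNegative 0≤q}}}}

+-nonNeg : ∀ {p q} → 0ℚ ℚ.≤ p → 0ℚ ℚ.≤ q → 0ℚ ℚ.≤ p ℚ.+ q
+-nonNeg {p} {q} 0≤p 0≤q =
  ℚ.nonNegative⁻¹ _ {{ℚ.nonNeg+nonNeg⇒nonNeg p {{ℚ.nonNegative 0≤p}} q {{ℚ.nonNegative 0≤q}}}}

archimedean : ∀ X → 0ℚ ℚ.≤ X → ∃ λ n → X ℚ.≤ ℕtoℚ n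
archimedean (mkℚ (+ a) d c) _ =
  a , subst (mkℚ (+ a) d c ℚ.≤_) (sym (ℤtoℚ≡mkℚ (+ a))) (ℚ.*≤* (ℤ.*-monoˡ-≤-nonNeg (+ a) (ℤ.+≤+ (ℕ.s≤s ℕ.z≤n))))
archimedean (mkℚ -[1+ a ] d _) (ℚ.*≤* ())

÷≡/ : ∀ a N .{{_ : ℕ.NonZero N}} → a ÷ N ≡ a / N
÷≡/ a (suc _) = refl

f-/-* : ∀ a N .{{_ : ℕ.NonZero N}} → f (a / N) ℚ.* ℕtoℚ N ≡ ℤtoℚ (a - floor (a / N ℚ.+ ½) * + N)
f-/-* a N = begin
  (z ℚ.- ℤtoℚ F) ℚ.* ℕtoℚ N            ≡⟨ distrib z (ℤtoℚ F) (ℕtoℚ N) ⟩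
  z ℚ.* ℕtoℚ N ℚ.- ℤtoℚ F ℚ.* ℕtoℚ N   ≡⟨ cong₂ ℚ._-_ (/-*-cancel a N) (sym (ℤtoℚ-* F (+ N))) ⟩
  ℤtoℚ a ℚ.- ℤtoℚ (F * + N)            ≡⟨ ℤtoℚ-- a (F * + N) ⟨
  ℤtoℚ (a - F * + N)                   ∎
  where
  open ≡-Reasoning
  z : ℚ
  z = a / N
  F : ℤ
  F = floor (z ℚ.+ ½)
  distrib : ∀ z w n → (z ℚ.- w) ℚ.* n ≡ z ℚ.* n ℚ.- w ℚ.* n
  distrib = solve-∀ ℚ-ring

-- Counting Gaussian integers of bounded norm

∈-─ : ∀ {A : Set} {x y : A} {ys} (x∈ys : x ∈ ys) → y ∈ ys → y ≢ x → y ∈ (ys ─ x∈ys)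
∈-─ (here refl)  (here refl)  y≢x = ⊥-elim (y≢x refl)
∈-─ (here _)     (there y∈ys) _   = y∈ys
∈-─ (there _)    (here refl)  _   = here refl
∈-─ (there x∈ys) (there y∈ys) y≢x = there (∈-─ x∈ys y∈ys y≢x)

unique-⊆⇒length≤ : ∀ {A : Set} {xs ys : List A} → Unique xs → xs ⊆ ys → length xs ℕ.≤ length ys
unique-⊆⇒length≤ {xs = []}     _               _       = ℕ.z≤n
unique-⊆⇒length≤ {xs = x ∷ xs} {ys} (x≢xs ∷ unique) x∷xs⊆ys = begin
  suc (length xs)           ≤⟨ ℕ.s≤s (unique-⊆⇒length≤ unique xs⊆ys─x) ⟩
  suc (length (ys ─ x∈ys))  ≡⟨ length-removeAt′ ys (index x∈ys) ⟨
  length ys                 ∎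
  where
  open ℕ.≤-Reasoning
  x∈ys : x ∈ ys
  x∈ys = x∷xs⊆ys (here refl)
  xs⊆ys─x : xs ⊆ (ys ─ x∈ys)
  xs⊆ys─x y∈xs = ∈-─ x∈ys (x∷xs⊆ys (there y∈xs)) (λ y≡x → All.lookup x≢xs y∈xs (sym y≡x))

length-cartesianProduct : ∀ {A B : Set} (xs : List A) (ys : List B) →
                          length (cartesianProduct xs ys) ≡ length xs ℕ.* length ys
length-cartesianProduct []       ys = refl
length-cartesianProduct (x ∷ xs) ys = begin
  length (map (x ,_) ys ++ cartesianProduct xs ys)            ≡⟨ length-++ (map (x ,_) ys) ⟩
  length (map (x ,_) ys) ℕ.+ length (cartesianProduct xs ys)  ≡⟨ cong₂ ℕ._+_ (length-map (x ,_) ys) (length-cartesianProduct xs ys) ⟩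
  length ys ℕ.+ length xs ℕ.* length ys                       ∎
  where open ≡-Reasoning

interval : ℕ → List ℤ
interval n = applyUpTo +_ (suc n) ++ applyUpTo -[1+_] n

length-interval : ∀ n → length (interval n) ≡ suc (n ℕ.+ n)
length-interval n = trans (length-++ (applyUpTo +_ (suc n)))
  (cong₂ ℕ._+_ (length-applyUpTo +_ (suc n)) (length-applyUpTo -[1+_] n))

∈-interval : ∀ {n} i → ∣ i ∣ ℕ.≤ n → i ∈ interval n
∈-interval (+ m)    m≤n   = ∈-++⁺ˡ (∈-applyUpTo⁺ +_ (ℕ.s≤s m≤n))
∈-interval -[1+ m ] 1+m≤n = ∈-++⁺ʳ (applyUpTo +_ _) (∈-applyUpTo⁺ -[1+_] 1+m≤n)

greatest : ∀ {P : ℕ → Set} → Decidable P → P 0 → ∀ B → (∀ {j} → P j → j ℕ.≤ B) →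
           ∃ λ k → P k × (∀ {j} → P j → j ℕ.≤ k)
greatest         P? P0 zero    bounded = 0 , P0 , bounded
greatest {P = P} P? P0 (suc B) bounded with P? (suc B)
... | yes P[1+B] = suc B , P[1+B] , bounded
... | no ¬P[1+B] = greatest P? P0 B λ {j} Pj →
  ℕ.≤-pred (ℕ.≤∧≢⇒< (bounded Pj) (λ j≡1+B → ¬P[1+B] (subst P j≡1+B Pj)))

n≤n*n : ∀ n → n ℕ.≤ n ℕ.* n
n≤n*n zero    = ℕ.z≤n
n≤n*n (suc n) = ℕ.m≤m*n (suc n) (suc n)

∃-⌊√⌋ : ∀ X → 0ℚ ℚ.≤ X →
        ∃ λ k → ℕtoℚ (k ℕ.* k) ℚ.≤ X × (∀ {j} → ℕtoℚ (j ℕ.* j) ℚ.≤ X → j ℕ.≤ k)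
∃-⌊√⌋ X 0≤X =
  let B , X≤B = archimedean X 0≤X
  in greatest (λ j → ℕtoℚ (j ℕ.* j) ℚ.≤? X) 0≤X B λ {j} j*j≤X →
       ℕ.≤-trans (n≤n*n j) (ℤ.drop‿+≤+ (ℤtoℚ-cancel-≤ (ℚ.≤-trans j*j≤X X≤B)))

[2k+1]²≤8k²+2 : ∀ k → suc (k ℕ.+ k) ℕ.* suc (k ℕ.+ k) ℕ.≤ 8 ℕ.* (k ℕ.* k) ℕ.+ 2
[2k+1]²≤8k²+2 k = begin
  suc (k ℕ.+ k) ℕ.* suc (k ℕ.+ k)                   ≡⟨ solve (k ∷ []) ℕ-ring ⟩
  4 ℕ.* (k ℕ.* k) ℕ.+ 4 ℕ.* k ℕ.+ 1                 ≤⟨ ℕ.+-monoˡ-≤ 1 (ℕ.+-monoʳ-≤ (4 ℕ.* (k ℕ.* k)) (ℕ.*-monoʳ-≤ 4 (n≤n*n k))) ⟩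
  4 ℕ.* (k ℕ.* k) ℕ.+ 4 ℕ.* (k ℕ.* k) ℕ.+ 1         ≤⟨ ℕ.n≤1+n _ ⟩
  suc (4 ℕ.* (k ℕ.* k) ℕ.+ 4 ℕ.* (k ℕ.* k) ℕ.+ 1)   ≡⟨ solve (k ∷ []) ℕ-ring ⟩
  8 ℕ.* (k ℕ.* k) ℕ.+ 2                             ∎
  where open ℕ.≤-Reasoning

∣re∣²≤∥∥ : ∀ a b → + (∣ a ∣ ℕ.* ∣ a ∣) ℤ.≤ ∥ (a , b) ∥
∣re∣²≤∥∥ a b = begin
  + (∣ a ∣ ℕ.* ∣ a ∣)  ≡⟨ cong +_ (ℤ.abs-* a a) ⟨
  + ∣ a * a ∣          ≡⟨ ℤ.0≤i⇒+∣i∣≡i (0≤i*i a) ⟩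
  a * a                ≤⟨ ℤ.i≤i+j (a * a) (b * b) {{ℤ.nonNegative (0≤i*i b)}} ⟩
  a * a + b * b        ∎
  where open ℤ.≤-Reasoning

square : ℕ → List GI
square k = cartesianProduct (interval k) (interval k)

∈-square : ∀ {X k} → (∀ {j} → ℕtoℚ (j ℕ.* j) ℚ.≤ X → j ℕ.≤ k) → ∀ {z} → ℤtoℚ ∥ z ∥ ℚ.≤ X → z ∈ square k
∈-square {X} {k} maximal {a , b} ∥z∥≤X =
  ∈-cartesianProduct⁺ (∈-interval a (∣re∣≤k a b ∥z∥≤X))
    (∈-interval b (∣re∣≤k b a (subst (ℚ._≤ X) (cong ℤtoℚ (ℤ.+-comm (a * a) (b * b))) ∥z∥≤X)))
  where
  ∣re∣≤k : ∀ a b → ℤtoℚ ∥ (a , b) ∥ ℚ.≤ X → ∣ a ∣ ℕ.≤ k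
  ∣re∣≤k a b ∥z∥≤X = maximal (ℚ.≤-trans (ℤtoℚ-mono-≤ (∣re∣²≤∥∥ a b)) ∥z∥≤X)

length-square≤ : ∀ k → ℕtoℚ (length (square k)) ℚ.≤ ℕtoℚ 8 ℚ.* ℕtoℚ (k ℕ.* k) ℚ.+ ℕtoℚ 2
length-square≤ k = begin
  ℕtoℚ (length (square k))                 ≡⟨ cong ℕtoℚ (trans (length-cartesianProduct (interval k) (interval k))
                                                             (cong₂ ℕ._*_ (length-interval k) (length-interval k))) ⟩
  ℕtoℚ (suc (k ℕ.+ k) ℕ.* suc (k ℕ.+ k))   ≤⟨ ℕtoℚ-mono-≤ ([2k+1]²≤8k²+2 k) ⟩
  ℕtoℚ (8 ℕ.* (k ℕ.* k) ℕ.+ 2)             ≡⟨ trans (ℕtoℚ-+ (8 ℕ.* (k ℕ.* k)) 2) (cong (ℚ._+ ℕtoℚ 2) (ℕtoℚ-* 8 (k ℕ.* k))) ⟩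
  ℕtoℚ 8 ℚ.* ℕtoℚ (k ℕ.* k) ℚ.+ ℕtoℚ 2     ∎
  where open ℚ.≤-Reasoning

disc-cover : ∀ X → 0ℚ ℚ.≤ X →
             ∃ λ (D : List GI) → (∀ {z} → ℤtoℚ ∥ z ∥ ℚ.≤ X → z ∈ D)
                               × ℕtoℚ (length D) ℚ.≤ ℕtoℚ 8 ℚ.* X ℚ.+ ℕtoℚ 2
disc-cover X 0≤X =
  let k , k*k≤X , maximal = ∃-⌊√⌋ X 0≤X
  in square k , ∈-square maximal ,
     ℚ.≤-trans (length-square≤ k) (ℚ.+-monoˡ-≤ (ℕtoℚ 2) (ℚ.*-monoˡ-≤-nonNeg (ℕtoℚ 8) k*k≤X))

count-by-covers : ∀ {A : Set} {xs : List A} {D₁ D₂ : List GI} (κ : A → GI × GI) →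
                  (∀ {x y} → κ x ≡ κ y → x ≡ y) → Unique xs →
                  All (λ x → proj₁ (κ x) ∈ D₁ × proj₂ (κ x) ∈ D₂) xs → length xs ℕ.≤ length D₁ ℕ.* length D₂
count-by-covers {xs = xs} {D₁} {D₂} κ κ-injective unique covered = begin
  length xs                        ≡⟨ length-map κ xs ⟨
  length (map κ xs)                ≤⟨ unique-⊆⇒length≤ (Unique.map⁺ κ-injective unique) κ[xs]⊆D₁×D₂ ⟩
  length (cartesianProduct D₁ D₂)  ≡⟨ length-cartesianProduct D₁ D₂ ⟩
  length D₁ ℕ.* length D₂          ∎
  where
  open ℕ.≤-Reasoning
  κ[xs]⊆D₁×D₂ : map κ xs ⊆ cartesianProduct D₁ D₂
  κ[xs]⊆D₁×D₂ z∈κ[xs] with x , x∈xs , refl ← ∈-map⁻ κ z∈κ[xs] =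
    ∈-cartesianProduct⁺ (proj₁ (All.lookup covered x∈xs)) (proj₂ (All.lookup covered x∈xs))

count-by-norms : ∀ {A : Set} {xs : List A} (κ : A → GI × GI) → (∀ {x y} → κ x ≡ κ y → x ≡ y) → Unique xs →
                 ∀ {X Y} → 0ℚ ℚ.≤ X → 0ℚ ℚ.≤ Y →
                 All (λ x → ℤtoℚ ∥ proj₁ (κ x) ∥ ℚ.≤ X × ℤtoℚ ∥ proj₂ (κ x) ∥ ℚ.≤ Y) xs →
                 ℕtoℚ (length xs) ℚ.≤ (ℕtoℚ 8 ℚ.* X ℚ.+ ℕtoℚ 2) ℚ.* (ℕtoℚ 8 ℚ.* Y ℚ.+ ℕtoℚ 2)
count-by-norms {xs = xs} κ κ-injective unique {X} {Y} 0≤X 0≤Y bounded =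
  let D₁ , covers₁ , size₁ = disc-cover X 0≤X
      D₂ , covers₂ , size₂ = disc-cover Y 0≤Y
      covered = All.map (λ (b₁ , b₂) → covers₁ b₁ , covers₂ b₂) bounded
  in begin
    ℕtoℚ (length xs)                       ≤⟨ ℕtoℚ-mono-≤ (count-by-covers κ κ-injective unique covered) ⟩
    ℕtoℚ (length D₁ ℕ.* length D₂)          ≡⟨ ℕtoℚ-* (length D₁) (length D₂) ⟩
    ℕtoℚ (length D₁) ℚ.* ℕtoℚ (length D₂)
      ≤⟨ *-mono-≤-nonNeg (0≤ℕtoℚ (length D₁)) (ℚ.≤-trans (0≤ℕtoℚ (length D₂)) size₂) size₁ size₂ ⟩
    (ℕtoℚ 8 ℚ.* X ℚ.+ ℕtoℚ 2) ℚ.* (ℕtoℚ 8 ℚ.* Y ℚ.+ ℕtoℚ 2) ∎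
  where open ℚ.≤-Reasoning

-- The injection q ↦ (t q , q divᵍ q₂)

module Key (q₂ r₂ : GI) .{{_ : ℕ.NonZero (𝒩 q₂)}} where

  N : ℕ
  N = 𝒩 q₂

  k l : ℤ
  k = re r₂ * re q₂ + im r₂ * im q₂
  l = re r₂ * im q₂ - im r₂ * re q₂

  A B : GI → ℤ
  A q = re q * k + im q * l
  B q = - im q * k + re q * l

  nearest centre : ℤ → ℤ
  nearest a = floor (a / N ℚ.+ ½)
  centre a = a - nearest a * + N

  -- Since q r₂ conj(q₂) = (A q , - B q), g q is the Gaussian integer nearest to q r₂ / q₂.
  g t : GI → GI
  g q = (nearest (A q) , - nearest (B q))
  t q = q *ᵍ r₂ -ᵍ g q *ᵍ q₂

  key : GI → GI × GI
  key q = t q , q divᵍ q₂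

  *r₂*conj-q₂ : ∀ q → (q *ᵍ r₂) *ᵍ conj q₂ ≡ (A q , - B q)
  *r₂*conj-q₂ (u , v) =
    cong₂ _,_ (real u v (re r₂) (im r₂) (re q₂) (im q₂)) (imaginary u v (re r₂) (im r₂) (re q₂) (im q₂))
    where
    real : ∀ u v x y u₂ v₂ → (u * x - v * y) * u₂ - (u * y + v * x) * - v₂
                           ≡ u * (x * u₂ + y * v₂) + v * (x * v₂ - y * u₂)
    real = solve-∀ ℤ-ring
    imaginary : ∀ u v x y u₂ v₂ → (u * x - v * y) * - v₂ + (u * y + v * x) * u₂
                                ≡ - (- v * (x * u₂ + y * v₂) + u * (x * v₂ - y * u₂))
    imaginary = solve-∀ ℤ-ring

  t-*-conj : ∀ q → t q *ᵍ conj q₂ ≡ (centre (A q) , - centre (B q))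
  t-*-conj q = begin
    (q *ᵍ r₂ -ᵍ g q *ᵍ q₂) *ᵍ conj q₂                  ≡⟨ distrib (q *ᵍ r₂) (g q) q₂ (conj q₂) ⟩
    (q *ᵍ r₂) *ᵍ conj q₂ -ᵍ g q *ᵍ (q₂ *ᵍ conj q₂)    ≡⟨ cong₂ (λ u v → u -ᵍ g q *ᵍ v) (*r₂*conj-q₂ q) (*-conj q₂) ⟩
    (A q , - B q) -ᵍ g q *ᵍ [ + N ]ᵍ                    ≡⟨ cong (λ z → (A q , - B q) -ᵍ z) (*ᵍ-[] (g q) (+ N)) ⟩
    (A q - nearest (A q) * + N , - B q - - nearest (B q) * + N) ≡⟨ cong (centre (A q) ,_) (negate (B q) (nearest (B q)) (+ N)) ⟩
    (centre (A q) , - centre (B q))                     ∎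
    where
    open ≡-Reasoning
    distrib : ∀ p g q c → (p -ᵍ g *ᵍ q) *ᵍ c ≡ p *ᵍ c -ᵍ g *ᵍ (q *ᵍ c)
    distrib = solve-∀ ℤ[i]-ring
    negate : ∀ b n N → - b - - n * N ≡ - (b - n * N)
    negate = solve-∀ ℤ-ring

  ∥t∥*N : ∀ q → ∥ t q ∥ * + N ≡ centre (A q) * centre (A q) + centre (B q) * centre (B q)
  ∥t∥*N q = begin
    ∥ t q ∥ * + N                       ≡⟨ cong (∥ t q ∥ *_) (trans (+𝒩≡∥∥ q₂) (sym (∥conj∥ q₂))) ⟩
    ∥ t q ∥ * ∥ conj q₂ ∥               ≡⟨ ∥∥-* (t q) (conj q₂) ⟨
    ∥ t q *ᵍ conj q₂ ∥                  ≡⟨ cong ∥_∥ (t-*-conj q) ⟩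
    ∥ conj (centre (A q) , centre (B q)) ∥ ≡⟨ ∥conj∥ (centre (A q) , centre (B q)) ⟩
    centre (A q) * centre (A q) + centre (B q) * centre (B q) ∎
    where open ≡-Reasoning

  ∥t∥≤ : ∀ {R} q → InDisk R q₂ r₂ q → ℤtoℚ ∥ t q ∥ ℚ.≤ R ℚ.* R ℚ.* ℕtoℚ N
  ∥t∥≤ {R} q inDisk = ℚ.*-cancelʳ-≤-pos (ℕtoℚ N) {{ℕtoℚ-positive N}} (begin
    ℤtoℚ ∥ t q ∥ ℚ.* ℕtoℚ N                                       ≡⟨ ℤtoℚ-* ∥ t q ∥ (+ N) ⟨
    ℤtoℚ (∥ t q ∥ * + N)                                           ≡⟨ cong ℤtoℚ (∥t∥*N q) ⟩
    ℤtoℚ (centre (A q) * centre (A q) + centre (B q) * centre (B q)) ≡⟨ ℤtoℚ-squares (centre (A q)) (centre (B q)) ⟩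
    ℤtoℚ (centre (A q)) ℚ.* ℤtoℚ (centre (A q)) ℚ.+ ℤtoℚ (centre (B q)) ℚ.* ℤtoℚ (centre (B q))
      ≡⟨ cong₂ (λ x y → x ℚ.* x ℚ.+ y ℚ.* y) (f-/-* (A q) N) (f-/-* (B q) N) ⟨
    (a ℚ.* n) ℚ.* (a ℚ.* n) ℚ.+ (b ℚ.* n) ℚ.* (b ℚ.* n)           ≡⟨ factor a b n ⟩
    (a ℚ.* a ℚ.+ b ℚ.* b) ℚ.* (n ℚ.* n)
      ≤⟨ ℚ.*-monoʳ-≤-nonNeg (n ℚ.* n) {{ℚ.nonNegative (*-nonNeg 0≤n 0≤n)}} inDisk′ ⟩
    (R ℚ.* R) ℚ.* (n ℚ.* n)                                        ≡⟨ ℚ.*-assoc (R ℚ.* R) n n ⟨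
    R ℚ.* R ℚ.* n ℚ.* n                                            ∎)
    where
    open ℚ.≤-Reasoning
    a b n : ℚ
    a = f (A q / N)
    b = f (B q / N)
    n = ℕtoℚ N
    0≤n : 0ℚ ℚ.≤ n
    0≤n = 0≤ℕtoℚ N
    inDisk′ : a ℚ.* a ℚ.+ b ℚ.* b ℚ.≤ R ℚ.* R
    inDisk′ = subst₂ (λ x y → f x ℚ.* f x ℚ.+ f y ℚ.* f y ℚ.≤ R ℚ.* R) (÷≡/ (A q) N) (÷≡/ (B q) N) inDisk
    factor : ∀ a b n → (a ℚ.* n) ℚ.* (a ℚ.* n) ℚ.+ (b ℚ.* n) ℚ.* (b ℚ.* n)
                     ≡ (a ℚ.* a ℚ.+ b ℚ.* b) ℚ.* (n ℚ.* n)
    factor = solve-∀ ℚ-ring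
    ℤtoℚ-squares : ∀ x y → ℤtoℚ (x * x + y * y) ≡ ℤtoℚ x ℚ.* ℤtoℚ x ℚ.+ ℤtoℚ y ℚ.* ℤtoℚ y
    ℤtoℚ-squares x y = trans (ℤtoℚ-+ (x * x) (y * y)) (cong₂ ℚ._+_ (ℤtoℚ-* x x) (ℤtoℚ-* y y))

  ∥divᵍ∥≤ : ∀ {L Q} q → 0ℚ ℚ.≤ L → ½ ℚ.* Q ℚ.< ℕtoℚ N → ℕtoℚ (𝒩 q) ℚ.≤ L ℚ.* Q →
            ℤtoℚ ∥ q divᵍ q₂ ∥ ℚ.≤ ℕtoℚ 4 ℚ.* L ℚ.+ 1ℚ
  ∥divᵍ∥≤ {L} {Q} q 0≤L ½Q<n 𝒩q≤LQ = ℚ.*-cancelʳ-≤-pos n {{ℕtoℚ-positive N}} (begin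
    ℤtoℚ ∥ κ ∥ ℚ.* n                    ≡⟨ ℤtoℚ-* ∥ κ ∥ (+ N) ⟨
    ℤtoℚ (∥ κ ∥ * + N)                  ≤⟨ ℤtoℚ-mono-≤ (∥divᵍ∥ q q₂) ⟩
    ℤtoℚ (+ 2 * ∥ q ∥ + + N)            ≡⟨ trans (ℤtoℚ-+ (+ 2 * ∥ q ∥) (+ N)) (cong (ℚ._+ n) (ℤtoℚ-* (+ 2) ∥ q ∥)) ⟩
    ℕtoℚ 2 ℚ.* ℤtoℚ ∥ q ∥ ℚ.+ n         ≡⟨ cong (λ z → ℕtoℚ 2 ℚ.* ℤtoℚ z ℚ.+ n) (+𝒩≡∥∥ q) ⟨
    ℕtoℚ 2 ℚ.* ℕtoℚ (𝒩 q) ℚ.+ n         ≤⟨ ℚ.+-monoˡ-≤ n (ℚ.*-monoˡ-≤-nonNeg (ℕtoℚ 2) (ℚ.≤-trans 𝒩q≤LQ LQ≤2Ln)) ⟩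
    ℕtoℚ 2 ℚ.* (L ℚ.* (ℕtoℚ 2 ℚ.* n)) ℚ.+ n ≡⟨ collect L n ⟩
    (ℕtoℚ 4 ℚ.* L ℚ.+ 1ℚ) ℚ.* n         ∎)
    where
    open ℚ.≤-Reasoning
    κ : GI
    κ = q divᵍ q₂
    n : ℚ
    n = ℕtoℚ N
    Q≤2n : Q ℚ.≤ ℕtoℚ 2 ℚ.* n
    Q≤2n = begin
      Q                        ≡⟨ solve (Q ∷ []) ℚ-ring ⟩
      ℕtoℚ 2 ℚ.* (½ ℚ.* Q)     ≤⟨ ℚ.*-monoˡ-≤-nonNeg (ℕtoℚ 2) (ℚ.<⇒≤ ½Q<n) ⟩
      ℕtoℚ 2 ℚ.* n             ∎
    collect : ∀ L n → ℕtoℚ 2 ℚ.* (L ℚ.* (ℕtoℚ 2 ℚ.* n)) ℚ.+ n ≡ (ℕtoℚ 4 ℚ.* L ℚ.+ 1ℚ) ℚ.* n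
    collect = solve-∀ ℚ-ring
    LQ≤2Ln : L ℚ.* Q ℚ.≤ L ℚ.* (ℕtoℚ 2 ℚ.* n)
    LQ≤2Ln = ℚ.*-monoˡ-≤-nonNeg L {{ℚ.nonNegative 0≤L}} Q≤2n

  key-injective : CoprimeGI r₂ q₂ → ∀ {x y} → key x ≡ key y → x ≡ y
  key-injective coprime {x} {y} kx≡ky = ≡-mod-divᵍ x y q₂
    (coprime-∣-cancel (x -ᵍ y) coprime (g x -ᵍ g y , [gx-gy]q₂≡[x-y]r₂)) (cong proj₂ kx≡ky)
    where
    open ≡-Reasoning
    [gx-gy]q₂≡[x-y]r₂ : (g x -ᵍ g y) *ᵍ q₂ ≡ (x -ᵍ y) *ᵍ r₂
    [gx-gy]q₂≡[x-y]r₂ = begin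
      (g x -ᵍ g y) *ᵍ q₂                      ≡⟨ regroup x y r₂ (g x) (g y) q₂ ⟩
      (x -ᵍ y) *ᵍ r₂ -ᵍ (t x -ᵍ t y)          ≡⟨ cong (λ z → (x -ᵍ y) *ᵍ r₂ -ᵍ (z -ᵍ t y)) (cong proj₁ kx≡ky) ⟩
      (x -ᵍ y) *ᵍ r₂ -ᵍ (t y -ᵍ t y)          ≡⟨ sub-sub-self ((x -ᵍ y) *ᵍ r₂) (t y) ⟩
      (x -ᵍ y) *ᵍ r₂                          ∎
      where
      regroup : ∀ x y r gx gy q → (gx -ᵍ gy) *ᵍ q ≡ (x -ᵍ y) *ᵍ r -ᵍ ((x *ᵍ r -ᵍ gx *ᵍ q) -ᵍ (y *ᵍ r -ᵍ gy *ᵍ q))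
      regroup = solve-∀ ℤ[i]-ring
      sub-sub-self : ∀ p u → p -ᵍ (u -ᵍ u) ≡ p
      sub-sub-self = solve-∀ ℤ[i]-ring

  length-bound : ∀ {R Q L} {qs : List GI} → 0ℚ ℚ.< R → 1ℚ ℚ.≤ Q → 1ℚ ℚ.≤ L →
          ½ ℚ.* Q ℚ.< ℕtoℚ N → ℕtoℚ N ℚ.≤ Q → CoprimeGI r₂ q₂ → Unique qs →
          All (λ q → ℕtoℚ (𝒩 q) ℚ.≤ L ℚ.* Q × InDisk R q₂ r₂ q) qs →
          ℕtoℚ (length qs) ℚ.≤ (ℕtoℚ 8 ℚ.* (R ℚ.* R ℚ.* Q) ℚ.+ ℕtoℚ 2) ℚ.* (ℕtoℚ 8 ℚ.* (ℕtoℚ 4 ℚ.* L ℚ.+ 1ℚ) ℚ.+ ℕtoℚ 2)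
  length-bound {R} {Q} {L} 0<R 1≤Q 1≤L ½Q<N N≤Q coprime unique bounded =
    count-by-norms key (key-injective coprime) unique 0≤X 0≤Y (All.map (λ {q} → bounds {q}) bounded)
    where
    0≤L : 0ℚ ℚ.≤ L
    0≤L = ℚ.≤-trans (0≤ℕtoℚ 1) 1≤L
    0≤R*R : 0ℚ ℚ.≤ R ℚ.* R
    0≤R*R = *-nonNeg (ℚ.<⇒≤ 0<R) (ℚ.<⇒≤ 0<R)
    0≤X : 0ℚ ℚ.≤ R ℚ.* R ℚ.* Q
    0≤X = *-nonNeg 0≤R*R (ℚ.≤-trans (0≤ℕtoℚ 1) 1≤Q)
    0≤Y : 0ℚ ℚ.≤ ℕtoℚ 4 ℚ.* L ℚ.+ 1ℚ
    0≤Y = +-nonNeg (*-nonNeg (0≤ℕtoℚ 4) 0≤L) (0≤ℕtoℚ 1)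
    bounds : ∀ {q} → ℕtoℚ (𝒩 q) ℚ.≤ L ℚ.* Q × InDisk R q₂ r₂ q →
             ℤtoℚ ∥ t q ∥ ℚ.≤ R ℚ.* R ℚ.* Q × ℤtoℚ ∥ q divᵍ q₂ ∥ ℚ.≤ ℕtoℚ 4 ℚ.* L ℚ.+ 1ℚ
    bounds {q} (𝒩q≤LQ , inDisk) =
      ℚ.≤-trans (∥t∥≤ {R} q inDisk) (ℚ.*-monoˡ-≤-nonNeg (R ℚ.* R) {{ℚ.nonNegative 0≤R*R}} N≤Q) ,
      ∥divᵍ∥≤ {L} {Q} q 0≤L ½Q<N 𝒩q≤LQ

[8X+2][32L+10]≤336[1+X]L : ∀ {X L} → 0ℚ ℚ.≤ X → 1ℚ ℚ.≤ L →
  (ℕtoℚ 8 ℚ.* X ℚ.+ ℕtoℚ 2) ℚ.* (ℕtoℚ 8 ℚ.* (ℕtoℚ 4 ℚ.* L ℚ.+ 1ℚ) ℚ.+ ℕtoℚ 2)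
    ℚ.≤ ℕtoℚ 336 ℚ.* ((1ℚ ℚ.+ X) ℚ.* L)
[8X+2][32L+10]≤336[1+X]L {X} {L} 0≤X 1≤L = begin
  (ℕtoℚ 8 ℚ.* X ℚ.+ ℕtoℚ 2) ℚ.* (ℕtoℚ 8 ℚ.* (ℕtoℚ 4 ℚ.* L ℚ.+ 1ℚ) ℚ.+ ℕtoℚ 2)
    ≤⟨ *-mono-≤-nonNeg 0≤8X+2 0≤42L 8X+2≤8[1+X] 8[4L+1]+2≤42L ⟩
  (ℕtoℚ 8 ℚ.* (1ℚ ℚ.+ X)) ℚ.* (ℕtoℚ 42 ℚ.* L)  ≡⟨ solve (X ∷ L ∷ []) ℚ-ring ⟩
  ℕtoℚ 336 ℚ.* ((1ℚ ℚ.+ X) ℚ.* L)               ∎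
  where
  open ℚ.≤-Reasoning
  0≤L : 0ℚ ℚ.≤ L
  0≤L = ℚ.≤-trans (0≤ℕtoℚ 1) 1≤L
  0≤8X+2 : 0ℚ ℚ.≤ ℕtoℚ 8 ℚ.* X ℚ.+ ℕtoℚ 2
  0≤8X+2 = +-nonNeg (*-nonNeg (0≤ℕtoℚ 8) 0≤X) (0≤ℕtoℚ 2)
  0≤42L : 0ℚ ℚ.≤ ℕtoℚ 42 ℚ.* L
  0≤42L = *-nonNeg (0≤ℕtoℚ 42) 0≤L
  8X+2≤8[1+X] : ℕtoℚ 8 ℚ.* X ℚ.+ ℕtoℚ 2 ℚ.≤ ℕtoℚ 8 ℚ.* (1ℚ ℚ.+ X)
  8X+2≤8[1+X] = begin
    ℕtoℚ 8 ℚ.* X ℚ.+ ℕtoℚ 2   ≤⟨ ℚ.+-monoʳ-≤ (ℕtoℚ 8 ℚ.* X) (ℕtoℚ-mono-≤ {2} {8} (ℕ.s≤s (ℕ.s≤s ℕ.z≤n))) ⟩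
    ℕtoℚ 8 ℚ.* X ℚ.+ ℕtoℚ 8   ≡⟨ solve (X ∷ []) ℚ-ring ⟩
    ℕtoℚ 8 ℚ.* (1ℚ ℚ.+ X)     ∎
  8[4L+1]+2≤42L : ℕtoℚ 8 ℚ.* (ℕtoℚ 4 ℚ.* L ℚ.+ 1ℚ) ℚ.+ ℕtoℚ 2 ℚ.≤ ℕtoℚ 42 ℚ.* L
  8[4L+1]+2≤42L = begin
    ℕtoℚ 8 ℚ.* (ℕtoℚ 4 ℚ.* L ℚ.+ 1ℚ) ℚ.+ ℕtoℚ 2   ≡⟨ solve (L ∷ []) ℚ-ring ⟩
    ℕtoℚ 32 ℚ.* L ℚ.+ ℕtoℚ 10 ℚ.* 1ℚ             ≤⟨ ℚ.+-monoʳ-≤ (ℕtoℚ 32 ℚ.* L) (ℚ.*-monoˡ-≤-nonNeg (ℕtoℚ 10) 1≤L) ⟩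
    ℕtoℚ 32 ℚ.* L ℚ.+ ℕtoℚ 10 ℚ.* L              ≡⟨ solve (L ∷ []) ℚ-ring ⟩
    ℕtoℚ 42 ℚ.* L                                ∎

<ℕtoℚ⇒nonZero : ∀ {x} n → 0ℚ ℚ.≤ x → x ℚ.< ℕtoℚ n → ℕ.NonZero n
<ℕtoℚ⇒nonZero zero    0≤x x<0 = ⊥-elim (ℚ.<-irrefl refl (ℚ.≤-<-trans 0≤x x<0))
<ℕtoℚ⇒nonZero (suc _) _   _   = _

proposition2 : ∃ λ (C : ℕ) →
  (S : GI → Set) (Q L R : ℚ) → 1ℚ ℚ.≤ Q → 1ℚ ℚ.≤ L → 0ℚ ℚ.< R →
  (q₂ r₂ : GI) → S q₂ → ½ ℚ.* Q ℚ.< ℕtoℚ (𝒩 q₂) → ℕtoℚ (𝒩 q₂) ℚ.≤ Q → CoprimeGI r₂ q₂ →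
  (qs : List GI) → Unique qs →
  All (λ q → S q × (ℕtoℚ (𝒩 q) ℚ.≤ L ℚ.* Q) × InDisk R q₂ r₂ q) qs →
  ℕtoℚ (length qs) ℚ.≤ ℕtoℚ C ℚ.* ((1ℚ ℚ.+ R ℚ.* R ℚ.* Q) ℚ.* L)
proposition2 = 336 , λ S Q L R 1≤Q 1≤L 0<R q₂ r₂ _ ½Q<N N≤Q coprime qs unique bounded →
  let 0≤Q = ℚ.≤-trans (0≤ℕtoℚ 1) 1≤Q
      q₂≢0 = <ℕtoℚ⇒nonZero (𝒩 q₂) (ℚ.*-monoˡ-≤-nonNeg ½ 0≤Q) ½Q<N
  in ℚ.≤-trans (Key.length-bound q₂ r₂ {{q₂≢0}} 0<R 1≤Q 1≤L ½Q<N N≤Q coprime unique (All.map proj₂ bounded))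
               ([8X+2][32L+10]≤336[1+X]L (*-nonNeg (*-nonNeg (ℚ.<⇒≤ 0<R) (ℚ.<⇒≤ 0<R)) 0≤Q) 1≤L)
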